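{- For every integer $n \geq 1$, \[ \sum_{\substack{r,s \geq 0\\ r+s = n}} \mathcal{B}_{r,s} = 0. \]
   Context: The Bernoulli numbers $\mathbf{B}_n$ are defined by $\frac{t}{e^t-1} = \sum_{n \geq 0} \mathbf{B}_n \frac{t^n}{n!}$ (so $\mathbf{B}_1 = -\tfrac12$). For integers $r,s \geq 0$ define $\mathcal{B}_{r,s} = \sum_{\nu=0}^{r} \binom{r}{\nu} \mathbf{B}_{s+\nu}$. -}

module Defs where

open import Data.Nat as ℕ using (ℕ; zero; suc; _<ᵇ_)
open import Data.Nat.Combinatorics using (_C_)
open import Data.Integer as ℤ using (+_)
open import Data.Rational using (ℚ; 0ℚ; 1ℚ; _+_; _*_; -_; _/_)
open import Data.Bool using (if_then_else_)

binom : ℕ → ℕ → ℚ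
binom m k = (+ (m C k)) / 1

Σ< : ℕ → (ℕ → ℚ) → ℚ
Σ< zero    f = 0ℚ
Σ< (suc n) f = Σ< n f + f n

-- This recurrence is equivalent to  t/(e^t - 1) = Σ_n B_n t^n / n!
-- (compare coefficients of t^{m+1} in (e^t - 1) · Σ B_n t^n/n! = t); B_1 = -1/2.
bernStep : ℕ → (ℕ → ℚ) → ℚ
bernStep zero    prev = 1ℚ
bernStep (suc j) prev =
  - (((+ 1) / (suc (suc j))) * Σ< (suc j) (λ k → binom (suc (suc j)) k * prev k))

-- bernTable m k = B_k for k < m (0 otherwise).
bernTable : ℕ → ℕ → ℚ
bernTable zero    k = 0ℚ
bernTable (suc m) k = if k <ᵇ m then bernTable m k else bernStep m (bernTable m)

B : ℕ → ℚ
B n = bernTable (suc n) n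

𝓑 : ℕ → ℕ → ℚ
𝓑 r s = Σ< (suc r) (λ ν → binom r ν * B (s ℕ.+ ν))

{-# OPTIONS --safe #-}
module Submission where

-- Replace the Bernoulli numbers by an arbitrary sequence b and write 𝓑[ b ] for the
-- corresponding 𝓑. Pascal's rule gives 𝓑[b]_{r+1,s} = 𝓑[b]_{r,s} + 𝓑[b]_{r,s+1}, so the
-- diagonal sums D_N(b) = Σ_{r+s=N} 𝓑[b]_{r,s} obey, under N ↦ N+1 and b ↦ b ∘ suc, the same
-- recursion as the binomial transform; hence D_N(b) + b_{N+1} = Σ_{k≤N+1} C(N+1,k) b_k.
-- For b = 𝐁 and N ≥ 1 the right-hand side is 𝐁_{N+1}, since the recurrence defining the
-- Bernoulli numbers says Σ_{k≤m} C(m+1,k) 𝐁_k = 0 for m ≥ 1.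

open import Defs
open import Data.Nat using (ℕ; suc; _∸_)
open import Data.Rational using (0ℚ)
open import Relation.Binary.PropositionalEquality using (_≡_)

open import Algebra.Properties.Ring using (+-identityˡ-unique)
open import Data.Bool using (false)
open import Data.Bool.Properties using (T-≡)
import Data.Integer as ℤ
import Data.Integer.Properties as ℤ
import Data.Nat as ℕ
import Data.Nat.Properties as ℕ
open import Data.Nat.Combinatorics
  using (_C_; nCk+nC[k+1]≡[n+1]C[k+1]; nCk≡nC[n∸k]; nC1≡n; nCn≡1)
open import Data.Nat.Combinatorics.Specification using (k>n⇒nCk≡0)
open import Data.Rational using (ℚ; 1ℚ; _+_; _*_; -_; _/_; fromℚᵘ)
open import Data.Rational.Properties
  using ( +-identityˡ; +-identityʳ; +-assoc; *-identityˡ; *-zeroˡ; *-distribʳ-+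
        ; toℚᵘ-injective; toℚᵘ-homo-+; toℚᵘ-homo-*; toℚᵘ-fromℚᵘ; fromℚᵘ-cong
        ; +-*-ring)
open import Data.Rational.Solver using (module +-*-Solver)
import Data.Rational.Unnormalised as ℚᵘ
import Data.Rational.Unnormalised.Properties as ℚᵘ
open import Data.Sum using (inj₁; inj₂)
open import Function using (_∘_)
open import Function.Bundles using (Equivalence)
open import Relation.Binary.PropositionalEquality
  using (refl; sym; trans; cong; cong₂; module ≡-Reasoning)
open ≡-Reasoning

Σ<-cong : ∀ n {f g : ℕ → ℚ} → (∀ k → k ℕ.< n → f k ≡ g k) → Σ< n f ≡ Σ< n g
Σ<-cong ℕ.zero  f≡g = refl
Σ<-cong (suc n) f≡g =
  cong₂ _+_ (Σ<-cong n (λ k k<n → f≡g k (ℕ.m<n⇒m<1+n k<n))) (f≡g n (ℕ.n<1+n n))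

Σ<-+ : ∀ n (f g : ℕ → ℚ) → Σ< n (λ k → f k + g k) ≡ Σ< n f + Σ< n g
Σ<-+ ℕ.zero  f g = sym (+-identityˡ 0ℚ)
Σ<-+ (suc n) f g = begin
  Σ< n (λ k → f k + g k) + (f n + g n) ≡⟨ cong (_+ (f n + g n)) (Σ<-+ n f g) ⟩
  (Σ< n f + Σ< n g) + (f n + g n)      ≡⟨ interchange (Σ< n f) (Σ< n g) (f n) (g n) ⟩
  (Σ< n f + f n) + (Σ< n g + g n)      ∎
  where
  open +-*-Solver
  interchange : ∀ a b c d → (a + b) + (c + d) ≡ (a + c) + (b + d)
  interchange = solve 4 (λ a b c d → (a :+ b) :+ (c :+ d) := (a :+ c) :+ (b :+ d)) refl

Σ<-shift : ∀ n (f : ℕ → ℚ) → Σ< (suc n) f ≡ f 0 + Σ< n (f ∘ suc)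
Σ<-shift ℕ.zero  f = trans (+-identityˡ (f 0)) (sym (+-identityʳ (f 0)))
Σ<-shift (suc n) f = begin
  Σ< (suc n) f + f (suc n)           ≡⟨ cong (_+ f (suc n)) (Σ<-shift n f) ⟩
  (f 0 + Σ< n (f ∘ suc)) + f (suc n) ≡⟨ +-assoc (f 0) _ _ ⟩
  f 0 + Σ< (suc n) (f ∘ suc)         ∎

fromℚᵘ-homo-+ : ∀ p q → fromℚᵘ (p ℚᵘ.+ q) ≡ fromℚᵘ p + fromℚᵘ q
fromℚᵘ-homo-+ p q = toℚᵘ-injective (ℚᵘ.≃-trans (toℚᵘ-fromℚᵘ (p ℚᵘ.+ q))
  (ℚᵘ.≃-sym (ℚᵘ.≃-trans (toℚᵘ-homo-+ (fromℚᵘ p) (fromℚᵘ q))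
    (ℚᵘ.+-cong (toℚᵘ-fromℚᵘ p) (toℚᵘ-fromℚᵘ q)))))

fromℚᵘ-homo-* : ∀ p q → fromℚᵘ (p ℚᵘ.* q) ≡ fromℚᵘ p * fromℚᵘ q
fromℚᵘ-homo-* p q = toℚᵘ-injective (ℚᵘ.≃-trans (toℚᵘ-fromℚᵘ (p ℚᵘ.* q))
  (ℚᵘ.≃-sym (ℚᵘ.≃-trans (toℚᵘ-homo-* (fromℚᵘ p) (fromℚᵘ q))
    (ℚᵘ.*-cong (toℚᵘ-fromℚᵘ p) (toℚᵘ-fromℚᵘ q)))))

fromℕ : ℕ → ℚ
fromℕ m = ℤ.+ m / 1

fromℕ-+ : ∀ m n → fromℕ (m ℕ.+ n) ≡ fromℕ m + fromℕ n
fromℕ-+ m n = trans (fromℚᵘ-cong [m+n]≃m+n) (fromℚᵘ-homo-+ (ℤ.+ m ℚᵘ./ 1) (ℤ.+ n ℚᵘ./ 1))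
  where
  [m+n]≃m+n : ℤ.+ (m ℕ.+ n) ℚᵘ./ 1 ℚᵘ.≃ ℤ.+ m ℚᵘ./ 1 ℚᵘ.+ ℤ.+ n ℚᵘ./ 1
  [m+n]≃m+n = ℚᵘ.*≡* (cong (ℤ._* ℤ.+ 1) (trans (ℤ.pos-+ m n)
    (sym (cong₂ ℤ._+_ (ℤ.*-identityʳ (ℤ.+ m)) (ℤ.*-identityʳ (ℤ.+ n))))))

-- In ℚᵘ, 1 / (n+1) is literally the reciprocal of (n+1) / 1.
fromℕ-*-inverse : ∀ n → fromℕ (suc n) * (ℤ.+ 1 / suc n) ≡ 1ℚ
fromℕ-*-inverse n = trans (sym (fromℚᵘ-homo-* d (ℚᵘ.1/ d))) (fromℚᵘ-cong (ℚᵘ.*-inverseʳ d))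
  where d = ℤ.+ suc n ℚᵘ./ 1

binom-pascal : ∀ n k → binom (suc n) (suc k) ≡ binom n k + binom n (suc k)
binom-pascal n k =
  trans (cong fromℕ (sym (nCk+nC[k+1]≡[n+1]C[k+1] n k))) (fromℕ-+ (n C k) (n C suc k))

binom[n,1+n]≡0 : ∀ n → binom n (suc n) ≡ 0ℚ
binom[n,1+n]≡0 n = cong fromℕ (k>n⇒nCk≡0 (ℕ.n<1+n n))

binom[n,n]≡1 : ∀ n → binom n n ≡ 1ℚ
binom[n,n]≡1 n = cong fromℕ (nCn≡1 n)

binom[1+n,n]≡1+n : ∀ n → binom (suc n) n ≡ fromℕ (suc n)
binom[1+n,n]≡1+n n = cong fromℕ (begin
  suc n C n             ≡⟨ nCk≡nC[n∸k] (ℕ.n≤1+n n) ⟩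
  suc n C (suc n ∸ n)   ≡⟨ cong (suc n C_) (ℕ.m+n∸n≡m 1 n) ⟩
  suc n C 1             ≡⟨ nC1≡n (suc n) ⟩
  suc n                 ∎)

binomialTransform : (ℕ → ℚ) → ℕ → ℚ
binomialTransform f n = Σ< (suc n) (λ k → binom n k * f k)

binomialTransform-suc : ∀ f n →
  binomialTransform f (suc n) ≡ binomialTransform f n + binomialTransform (f ∘ suc) n
binomialTransform-suc f n = begin
  binomialTransform f (suc n)
    ≡⟨ Σ<-shift (suc n) _ ⟩
  f₀ + Σ< (suc n) (λ k → binom (suc n) (suc k) * f (suc k))
    ≡⟨ cong (f₀ +_) (Σ<-cong (suc n) (λ k _ → pascal k)) ⟩
  f₀ + Σ< (suc n) (λ k → binom n k * f (suc k) + binom n (suc k) * f (suc k))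
    ≡⟨ cong (f₀ +_) (Σ<-+ (suc n) _ _) ⟩
  f₀ + (binomialTransform (f ∘ suc) n + Σ< (suc n) (λ k → binom n (suc k) * f (suc k)))
    ≡⟨ swap f₀ _ _ ⟩
  (f₀ + Σ< (suc n) (λ k → binom n (suc k) * f (suc k))) + binomialTransform (f ∘ suc) n
    ≡⟨ cong (_+ binomialTransform (f ∘ suc) n) (sym (Σ<-shift (suc n) _)) ⟩
  Σ< (suc (suc n)) (λ k → binom n k * f k) + binomialTransform (f ∘ suc) n
    ≡⟨ cong (_+ binomialTransform (f ∘ suc) n) dropVanishing ⟩
  binomialTransform f n + binomialTransform (f ∘ suc) n
    ∎
  where
  -- binom n 0 and binom (suc n) 0 both reduce to 1ℚ.
  f₀ = 1ℚ * f 0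
  pascal : ∀ k → binom (suc n) (suc k) * f (suc k)
               ≡ binom n k * f (suc k) + binom n (suc k) * f (suc k)
  pascal k = trans (cong (_* f (suc k)) (binom-pascal n k))
                   (*-distribʳ-+ (f (suc k)) (binom n k) (binom n (suc k)))
  dropVanishing : Σ< (suc (suc n)) (λ k → binom n k * f k) ≡ binomialTransform f n
  dropVanishing = trans
    (cong (binomialTransform f n +_)
          (trans (cong (_* f (suc n)) (binom[n,1+n]≡0 n)) (*-zeroˡ (f (suc n)))))
    (+-identityʳ _)
  open +-*-Solver
  swap : ∀ a x y → a + (x + y) ≡ (a + y) + x
  swap = solve 3 (λ a x y → a :+ (x :+ y) := (a :+ y) :+ x) refl

𝓑[_] : (ℕ → ℚ) → ℕ → ℕ → ℚ
𝓑[ b ] r s = binomialTransform (λ ν → b (s ℕ.+ ν)) r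

𝓑[_]-pascal : ∀ b r s → 𝓑[ b ] (suc r) s ≡ 𝓑[ b ] r s + 𝓑[ b ] r (suc s)
𝓑[ b ]-pascal r s = trans (binomialTransform-suc (λ ν → b (s ℕ.+ ν)) r)
  (cong (𝓑[ b ] r s +_) (Σ<-cong (suc r) (λ ν _ → cong (λ t → binom r ν * b t) (ℕ.+-suc s ν))))

𝓑[_]-zero : ∀ b s → 𝓑[ b ] 0 s ≡ b s
𝓑[ b ]-zero s = begin
  0ℚ + 1ℚ * b (s ℕ.+ 0) ≡⟨ +-identityˡ _ ⟩
  1ℚ * b (s ℕ.+ 0)      ≡⟨ *-identityˡ _ ⟩
  b (s ℕ.+ 0)           ≡⟨ cong b (ℕ.+-identityʳ s) ⟩
  b s                   ∎

diagonalSum : (ℕ → ℚ) → ℕ → ℚ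
diagonalSum b N = Σ< (suc N) (λ r → 𝓑[ b ] r (N ∸ r))

diagonalSum-suc : ∀ b N →
  diagonalSum b (suc N) ≡ b (suc N) + (diagonalSum b N + diagonalSum (b ∘ suc) N)
diagonalSum-suc b N = begin
  diagonalSum b (suc N)
    ≡⟨ Σ<-shift (suc N) _ ⟩
  𝓑[ b ] 0 (suc N) + Σ< (suc N) (λ r → 𝓑[ b ] (suc r) (N ∸ r))
    ≡⟨ cong₂ _+_ (𝓑[ b ]-zero (suc N)) (Σ<-cong (suc N) (λ r _ → 𝓑[ b ]-pascal r (N ∸ r))) ⟩
  b (suc N) + Σ< (suc N) (λ r → 𝓑[ b ] r (N ∸ r) + 𝓑[ b ] r (suc (N ∸ r)))
    ≡⟨ cong (b (suc N) +_) (Σ<-+ (suc N) _ _) ⟩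
  b (suc N) + (diagonalSum b N + diagonalSum (b ∘ suc) N)
    ∎

diagonalSum+last≡binomialTransform : ∀ N b →
  diagonalSum b N + b (suc N) ≡ binomialTransform b (suc N)
diagonalSum+last≡binomialTransform ℕ.zero b =
  cong₂ _+_ (+-identityˡ (𝓑[ b ] 0 0)) (sym (*-identityˡ (b 1)))
diagonalSum+last≡binomialTransform (suc N) b = begin
  diagonalSum b (suc N) + b′ (suc N)
    ≡⟨ cong (_+ b′ (suc N)) (diagonalSum-suc b N) ⟩
  (b (suc N) + (diagonalSum b N + diagonalSum b′ N)) + b′ (suc N)
    ≡⟨ regroup (b (suc N)) (diagonalSum b N) (diagonalSum b′ N) (b′ (suc N)) ⟩
  (diagonalSum b N + b (suc N)) + (diagonalSum b′ N + b′ (suc N))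
    ≡⟨ cong₂ _+_ (diagonalSum+last≡binomialTransform N b)
                 (diagonalSum+last≡binomialTransform N b′) ⟩
  binomialTransform b (suc N) + binomialTransform b′ (suc N)
    ≡⟨ sym (binomialTransform-suc b (suc N)) ⟩
  binomialTransform b (suc (suc N))
    ∎
  where
  b′ = b ∘ suc
  open +-*-Solver
  regroup : ∀ x d d′ x′ → (x + (d + d′)) + x′ ≡ (d + x) + (d′ + x′)
  regroup = solve 4 (λ x d d′ x′ → (x :+ (d :+ d′)) :+ x′ := (d :+ x) :+ (d′ :+ x′)) refl

n<ᵇn≡false : ∀ n → (n ℕ.<ᵇ n) ≡ false
n<ᵇn≡false ℕ.zero  = refl
n<ᵇn≡false (suc n) = n<ᵇn≡false n

bernTable≡B : ∀ {k m} → k ℕ.< m → bernTable m k ≡ B k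
bernTable≡B {k} {suc m} k<1+m with ℕ.m≤n⇒m<n∨m≡n (ℕ.≤-pred k<1+m)
... | inj₂ refl = refl
... | inj₁ k<m rewrite Equivalence.to T-≡ (ℕ.<⇒<ᵇ k<m) = bernTable≡B k<m

B≡bernStep : ∀ n → B n ≡ bernStep n (bernTable n)
B≡bernStep n rewrite n<ᵇn≡false n = refl

B-recurrence : ∀ n →
  B (suc n) ≡ - ((ℤ.+ 1 / suc (suc n)) * Σ< (suc n) (λ k → binom (suc (suc n)) k * B k))
B-recurrence n = begin
  B (suc n)                            ≡⟨ B≡bernStep (suc n) ⟩
  bernStep (suc n) (bernTable (suc n))
    ≡⟨ cong (λ S → - ((ℤ.+ 1 / suc (suc n)) * S))
            (Σ<-cong (suc n) (λ k k<1+n → cong (binom (suc (suc n)) k *_) (bernTable≡B k<1+n))) ⟩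
  - ((ℤ.+ 1 / suc (suc n)) * Σ< (suc n) (λ k → binom (suc (suc n)) k * B k))
    ∎

Σ<-binom-B≡0 : ∀ n → Σ< (suc (suc n)) (λ k → binom (suc (suc n)) k * B k) ≡ 0ℚ
Σ<-binom-B≡0 n = begin
  S + binom (suc (suc n)) (suc n) * B (suc n)
    ≡⟨ cong₂ (λ x y → S + x * y) (binom[1+n,n]≡1+n (suc n)) (B-recurrence n) ⟩
  S + fromℕ (suc (suc n)) * (- (c * S))
    ≡⟨ reassociate S (fromℕ (suc (suc n))) c ⟩
  S + - ((fromℕ (suc (suc n)) * c) * S)
    ≡⟨ cong (λ t → S + - (t * S)) (fromℕ-*-inverse (suc n)) ⟩
  S + - (1ℚ * S)
    ≡⟨ cancel S ⟩
  0ℚ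
    ∎
  where
  c = ℤ.+ 1 / suc (suc n)
  S = Σ< (suc n) (λ k → binom (suc (suc n)) k * B k)
  open +-*-Solver
  reassociate : ∀ s x y → s + x * (- (y * s)) ≡ s + - ((x * y) * s)
  reassociate = solve 3 (λ s x y → s :+ x :* (:- (y :* s)) := s :+ (:- ((x :* y) :* s))) refl
  cancel : ∀ s → s + - (1ℚ * s) ≡ 0ℚ
  cancel = solve 1 (λ s → s :+ (:- (con 1ℚ :* s)) := con 0ℚ) refl

binomialTransform-B : ∀ n → binomialTransform B (suc (suc n)) ≡ B (suc (suc n))
binomialTransform-B n = begin
  Σ< (suc (suc n)) (λ k → binom (suc (suc n)) k * B k)
    + binom (suc (suc n)) (suc (suc n)) * B (suc (suc n))
    ≡⟨ cong₂ (λ S x → S + x * B (suc (suc n))) (Σ<-binom-B≡0 n) (binom[n,n]≡1 (suc (suc n))) ⟩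
  0ℚ + 1ℚ * B (suc (suc n))
    ≡⟨ trans (+-identityˡ _) (*-identityˡ _) ⟩
  B (suc (suc n))
    ∎

lemma1p1 : (n : ℕ) → Σ< (suc (suc n)) (λ r → 𝓑 r (suc n ∸ r)) ≡ 0ℚ
lemma1p1 n = +-identityˡ-unique +-*-ring (diagonalSum B (suc n)) (B (suc (suc n))) (begin
  diagonalSum B (suc n) + B (suc (suc n)) ≡⟨ diagonalSum+last≡binomialTransform (suc n) B ⟩
  binomialTransform B (suc (suc n))       ≡⟨ binomialTransform-B n ⟩
  B (suc (suc n))                         ∎)
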